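{- A network $N$ has the global lca-property if and only if, for every strict $K_{2,2}$-subdivision $H\subseteq N$, there exists a subgraph $H'\subseteq N$ that is an $X$-subdivision or an $X'$-subdivision and satisfies $L(H')=L(H)$ and $R(H')=R(H)$.
   Context: A DAG is a finite directed graph without loops and directed cycles. For a DAG $G$, $u\preceq_G v$ means there is a directed path from $v$ to $u$ (including $u=v$); $L(G)$ is the set of $\preceq_G$-minimal vertices (leaves) and $R(G)$ the set of $\preceq_G$-maximal vertices (roots). A network is a DAG with $|R(G)|=1$. For non-empty $A\subseteq V(G)$, $\mathrm{LCA}_G(A)$ is the set of $\preceq_G$-minimal vertices $v$ with $a\preceq_G v$ for all $a\in A$; $G$ has the global lca-property if $|\mathrm{LCA}_G(A)|=1$ for all non-empty $A\subseteq V(G)$. An edge-subdivision replaces an edge $(x,y)$ by edges $(x,z),(z,y)$ for a new vertex $z$; a subdivision of a graph $F$ is obtained by a sequence of edge-subdivisions; a subgraph $H\subseteq G$ is an $F$-subdivision if it is isomorphic to a subdivision of $F$. $K_{2,2}$ is the DAG with vertices $r_1,r_2,l_1,l_2$ and edges $(r_i,l_j)$, $1\le i,j\le 2$. A strict $K_{2,2}$-subdivision of $G$ is a $K_{2,2}$-subdivision $H\subseteq G$ such that the two vertices of $R(H)$ are $\preceq_G$-incomparable and the two vertices of $L(H)$ are $\preceq_G$-incomparable. $X$ is the DAG with vertices $r_1,r_2,v,l_1,l_2$ and edges $(r_i,v),(v,l_i)$, $i=1,2$; $X'$ is the DAG with vertices $r_1,r_2,v,w,l_1,l_2$ and edges $(v,w)$,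 $(r_i,v)$, $(w,l_i)$, $i=1,2$. -}

module Defs where

open import Data.Nat using (ℕ; suc)
open import Data.Fin using (Fin; zero; suc; _≟_)
open import Data.Fin.Subset using (Subset; _∈_; Nonempty)
open import Data.Bool using (Bool; true; false; _∧_; not)
open import Data.Product using (Σ; ∃; ∃-syntax; _×_; _,_)
open import Data.Sum using (_⊎_)
open import Relation.Nullary using (¬_)
open import Relation.Nullary.Decidable using (⌊_⌋)
open import Relation.Binary.PropositionalEquality using (_≡_; _≢_)
open import Function.Definitions using (Injective)

Digraph : ℕ → Set
Digraph n = Fin n → Fin n → Bool

Edge : ∀ {n} → Digraph n → Fin n → Fin n → Set
Edge E u v = E u v ≡ true

-- u ⪯ v : there is a directed path from v to u (including u = v).
data _⪯⟨_⟩_ {n} (u : Fin n) (E : Digraph n) : Fin n → Set where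
  here  : u ⪯⟨ E ⟩ u
  there : ∀ {v w} → Edge E v w → u ⪯⟨ E ⟩ w → u ⪯⟨ E ⟩ v

-- DAG: no loops and no directed cycles (an edge (u,v) together with a
-- path from v back to u, u = v allowed, would be a cycle / loop).
IsDAG : ∀ {n} → Digraph n → Set
IsDAG E = ∀ u v → Edge E u v → ¬ (u ⪯⟨ E ⟩ v)

IsLeaf : ∀ {n} → Digraph n → Fin n → Set
IsLeaf E a = ∀ b → b ⪯⟨ E ⟩ a → b ≡ a

IsRoot : ∀ {n} → Digraph n → Fin n → Set
IsRoot E a = ∀ b → a ⪯⟨ E ⟩ b → b ≡ a

IsNetwork : ∀ {n} → Digraph n → Set
IsNetwork E = IsDAG E × (∃[ r ] (IsRoot E r × (∀ r' → IsRoot E r' → r' ≡ r)))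

IsLCA : ∀ {n} → Digraph n → Subset n → Fin n → Set
IsLCA E A v = (∀ a → a ∈ A → a ⪯⟨ E ⟩ v)
            × (∀ w → (∀ a → a ∈ A → a ⪯⟨ E ⟩ w) → w ⪯⟨ E ⟩ v → w ≡ v)

GlobalLCA : ∀ {n} → Digraph n → Set
GlobalLCA {n} E = ∀ (A : Subset n) → Nonempty A →
  ∃[ v ] (IsLCA E A v × (∀ w → IsLCA E A w → w ≡ v))

-- Edge-subdivision of (x,y): the new vertex is zero, old vertex i becomes suc i.
subdivide : ∀ {m} → Digraph m → Fin m → Fin m → Digraph (suc m)
subdivide E x y zero    zero    = false
subdivide E x y zero    (suc b) = ⌊ b ≟ y ⌋
subdivide E x y (suc a) zero    = ⌊ a ≟ x ⌋
subdivide E x y (suc a) (suc b) = E a b ∧ not (⌊ a ≟ x ⌋ ∧ ⌊ b ≟ y ⌋)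

data Subdiv {k} (F : Digraph k) : (m : ℕ) → Digraph m → Set where
  base : Subdiv F k F
  step : ∀ {m S} → Subdiv F m S → (x y : Fin m) → Edge S x y →
         Subdiv F (suc m) (subdivide S x y)

-- A subgraph of G isomorphic to S: the image of an injective,
-- edge-preserving map f from the vertices of S into those of G.
record Embedding {n m} (G : Digraph n) (S : Digraph m) : Set where
  field
    f        : Fin m → Fin n
    inj      : Injective _≡_ _≡_ f
    edge-pres : ∀ a b → Edge S a b → Edge G (f a) (f b)
open Embedding public

record FSubdivision {k n} (F : Digraph k) (G : Digraph n) : Set where
  field
    m     : ℕ
    S     : Digraph m
    isSub : Subdiv F m S
    emb   : Embedding G S
open FSubdivision public

InL : ∀ {k n} {F : Digraph k} {G : Digraph n} → FSubdivision F G → Fin n → Set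
InL H v = ∃[ a ] (f (emb H) a ≡ v × IsLeaf (S H) a)

InR : ∀ {k n} {F : Digraph k} {G : Digraph n} → FSubdivision F G → Fin n → Set
InR H v = ∃[ a ] (f (emb H) a ≡ v × IsRoot (S H) a)

Incomparable : ∀ {n} → Digraph n → Fin n → Fin n → Set
Incomparable G u v = ¬ (u ⪯⟨ G ⟩ v) × ¬ (v ⪯⟨ G ⟩ u)

-- K_{2,2}: r1 = 0, r2 = 1, l1 = 2, l2 = 3
K22 : Digraph 4
K22 zero          (suc (suc _)) = true
K22 (suc zero)    (suc (suc _)) = true
K22 _             _             = false

-- X: r1 = 0, r2 = 1, v = 2, l1 = 3, l2 = 4
X : Digraph 5
X zero                   (suc (suc zero)) = true
X (suc zero)             (suc (suc zero)) = true
X (suc (suc zero))       (suc (suc (suc _))) = true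
X _                      _                = false

-- X': r1 = 0, r2 = 1, v = 2, w = 3, l1 = 4, l2 = 5
X' : Digraph 6
X' zero                     (suc (suc zero))       = true
X' (suc zero)               (suc (suc zero))       = true
X' (suc (suc zero))         (suc (suc (suc zero))) = true
X' (suc (suc (suc zero)))   (suc (suc (suc (suc _)))) = true
X' _                        _                      = false

IsStrict : ∀ {n} {G : Digraph n} → FSubdivision K22 G → Set
IsStrict {G = G} H =
  (∀ u v → InR H u → InR H v → u ≢ v → Incomparable G u v) ×
  (∀ u v → InL H u → InL H v → u ≢ v → Incomparable G u v)

SameLR : ∀ {k k' n} {F : Digraph k} {F' : Digraph k'} {G : Digraph n} →
         FSubdivision F G → FSubdivision F' G → Set
SameLR {n = n} H H' = (∀ (v : Fin n) → (InL H' v → InL H v) × (InL H v → InL H' v))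
                    × (∀ (v : Fin n) → (InR H' v → InR H v) × (InR H v → InR H' v))

XCondition : ∀ {n} → Digraph n → Set
XCondition G = ∀ (H : FSubdivision K22 G) → IsStrict H →
  (Σ (FSubdivision X G) (λ H' → SameLR H H')) ⊎ (Σ (FSubdivision X' G) (λ H' → SameLR H H'))

{-# OPTIONS --safe #-}
module Submission where

-- Subdivisions are built from interval models: labellings of the vertices of N that give each
-- chosen branch vertex g x a label of its own and every z with g b ≺ z ≺ g a the label of the
-- pattern edge (a , b). Paths through these open intervals are then internally disjoint and avoid
-- the branch vertices, so they realise a subdivision of the pattern with branch vertices g.
--
-- (⇒) Let H be a strict K₂,₂-subdivision with roots r₁ r₂ and leaves l₁ l₂. The minimal common
-- ancestors of l₁ and l₂ below r₁ and below r₂ are both lcas of {l₁ , l₂}, hence one vertex w,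
-- and a maximal u with w ⪯ u ⪯ r₁ , r₂ carries an X-subdivision (u = w) or an X′-subdivision
-- (u ≠ w) with the roots and leaves of H.
-- (⇐) A minimal common ancestor of A below the root is an lca of A. Suppose v₁ ≠ v₂ were two.
-- Take a maximal common descendant l₁ of v₁ and v₂ above some a ∈ A; it is not an lca, so some
-- b ∈ A is not below l₁, and a maximal common descendant l₂ above b differs from l₁. Minimal
-- common ancestors uᵢ ⪯ vᵢ of l₁ and l₂ span a strict K₂,₂-subdivision, and the centre c of an
-- X- or X′-subdivision with the same roots and leaves satisfies l₁ , l₂ ⪯ c ⪯ u₁ , u₂. So c is a
-- common descendant of v₁ and v₂ above l₁, hence c = l₁, and l₂ ⪯ l₁ contradicts the maximality
-- of l₂.

open import Defs
open import Data.Bool using (Bool; true; false; if_then_else_)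
open import Data.Bool.Properties using () renaming (_≟_ to _≟ᵇ_)
open import Data.Empty using (⊥; ⊥-elim)
open import Data.Unit using (⊤; tt)
open import Data.Fin using (Fin; zero; suc; _≟_)
open import Data.Fin.Induction using (spo-wellFounded; spo-noetherian)
open import Data.Fin.Properties using (all?; any?; suc-injective; injective⇒≤)
open import Data.Fin.Subset using (Subset; _∈_; Nonempty; ⁅_⁆; _∪_)
open import Data.Fin.Subset.Properties using (_∈?_; x∈⁅x⁆; x∈⁅y⁆⇒x≡y; x∈p∪q⁻; x∈p∪q⁺)
open import Data.Nat using (ℕ; zero; suc; _+_; _≤_)
open import Data.Nat.Properties using (m≤m+n; +-suc; <-irrefl; ≤-trans)
open import Data.Product using (Σ; ∃; ∃-syntax; _×_; _,_; proj₁; proj₂; map₂)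
open import Data.Product.Properties using (,-injective)
open import Data.Sum using (_⊎_; inj₁; inj₂; map₁)
open import Data.Vec using ([]; _∷_; lookup)
open import Function using (_∘_; id; flip)
open import Function.Bundles using (_⇔_; mk⇔; Equivalence)
import Function.Properties.Equivalence as ⇔
open import Function.Definitions using (Injective)
open import Induction.WellFounded using (WellFounded; Acc; acc)
open import Relation.Binary.Core using (Rel)
open import Relation.Binary.Definitions using (Transitive; Antisymmetric; Decidable)
open import Relation.Binary.Structures using (IsPartialOrder; IsStrictPartialOrder)
open import Relation.Binary.PropositionalEquality
  using (_≡_; _≢_; _≗_; refl; sym; trans; cong; subst; isEquivalence)
open import Relation.Binary.Construct.Closure.Transitive using (TransClosure; [_]; _∷_)
import Relation.Binary.Construct.NonStrictToStrict as NonStrictToStrict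
open import Relation.Nullary using (Dec; yes; no; ¬_; does; ¬?; contradiction)
open import Relation.Nullary.Decidable
  using (map′; dec-true; dec-false; from-yes; decidable-stable; _×-dec_; _⊎-dec_; _→-dec_)

open Equivalence using (to; from)

variable
  k n : ℕ

Loopless : Digraph n → Set
Loopless E = ∀ a → ¬ Edge E a a

Sink : Digraph n → Fin n → Set
Sink E a = ∀ b → ¬ Edge E a b

Source : Digraph n → Fin n → Set
Source E a = ∀ b → ¬ Edge E b a

module _ {E : Digraph n} where

  ⪯-trans : Transitive (_⪯⟨ E ⟩_)
  ⪯-trans p here        = p
  ⪯-trans p (there e q) = there e (⪯-trans p q)

  edge⇒⪯ : ∀ {u v} → Edge E u v → v ⪯⟨ E ⟩ u
  edge⇒⪯ e = there e here

  sink⇒leaf : ∀ {a} → Sink E a → IsLeaf E a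
  sink⇒leaf sink _ here        = refl
  sink⇒leaf sink _ (there e _) = ⊥-elim (sink _ e)

  source⇒root : ∀ {a} → Source E a → IsRoot E a
  source⇒root source _ here = refl
  source⇒root source b (there e p) with source⇒root source _ p
  ... | refl = ⊥-elim (source b e)

  leaf⇒sink : Loopless E → ∀ {a} → IsLeaf E a → Sink E a
  leaf⇒sink loopless leaf b e = loopless _ (subst (Edge E _) (leaf b (edge⇒⪯ e)) e)

  root⇒source : Loopless E → ∀ {a} → IsRoot E a → Source E a
  root⇒source loopless root b e = loopless _ (subst (λ x → Edge E x _) (root b (edge⇒⪯ e)) e)

Path : Digraph n → Rel (Fin n) _
Path G = TransClosure (Edge G)

Interior : {G : Digraph n} {u v : Fin n} → Path G u v → Fin n → Set
Interior [ _ ]              z = ⊥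
Interior (_∷_ {y = w} _ p) z = z ≡ w ⊎ Interior p z

⪯⇒path : {G : Digraph n} {u w v : Fin n} → Edge G u w → v ⪯⟨ G ⟩ w → Path G u v
⪯⇒path e here          = [ e ]
⪯⇒path e (there e′ p) = e ∷ ⪯⇒path e′ p

module _ {ℓ} {_⊏_ : Rel (Fin n) ℓ} (⊏-wellFounded : WellFounded _⊏_) (⊏-trans : Transitive _⊏_)
         (_⊏?_ : Decidable _⊏_) {P : Fin n → Set} (P? : ∀ x → Dec (P x)) where

  ⊏-minimal : ∀ {x} → P x → ∃[ m ] (P m × (m ≡ x ⊎ m ⊏ x) × (∀ {z} → P z → ¬ z ⊏ m))
  ⊏-minimal {x} = descend (⊏-wellFounded x)
    where
    descend : ∀ {x} → Acc _⊏_ x → P x → ∃[ m ] (P m × (m ≡ x ⊎ m ⊏ x) × (∀ {z} → P z → ¬ z ⊏ m))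
    descend {x} (acc rs) px with any? (λ z → P? z ×-dec z ⊏? x)
    ... | no ∄smaller = x , px , inj₁ refl , λ pz z⊏x → ∄smaller (_ , pz , z⊏x)
    ... | yes (z , pz , z⊏x) with descend (rs z⊏x) pz
    ...   | m , pm , inj₁ refl , minimal = m , pm , inj₂ z⊏x , minimal
    ...   | m , pm , inj₂ m⊏z , minimal  = m , pm , inj₂ (⊏-trans m⊏z z⊏x) , minimal

module Order {E : Digraph n} (dag : IsDAG E) where

  infix 4 _⪯_ _⪯?_ _⪯ᵇ_

  _⪯_ : Rel (Fin n) _
  u ⪯ v = u ⪯⟨ E ⟩ v

  ⪯-antisym : Antisymmetric _≡_ _⪯_
  ⪯-antisym p here        = refl
  ⪯-antisym p (there e q) = ⊥-elim (dag _ _ e (⪯-trans p q))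

  ⪯-isPartialOrder : IsPartialOrder _≡_ _⪯_
  ⪯-isPartialOrder = record
    { isPreorder = record
      { isEquivalence = isEquivalence
      ; reflexive     = λ { refl → here }
      ; trans         = ⪯-trans
      }
    ; antisym = ⪯-antisym
    }

  open NonStrictToStrict _≡_ _⪯_ public using () renaming (_<_ to _≺_)

  ≺-isStrictPartialOrder : IsStrictPartialOrder _≡_ _≺_
  ≺-isStrictPartialOrder = NonStrictToStrict.<-isStrictPartialOrder _≡_ _⪯_ ⪯-isPartialOrder

  open IsStrictPartialOrder ≺-isStrictPartialOrder public
    using () renaming (irrefl to ≺-irrefl; trans to ≺-trans)

  ≺⇒⋡ : ∀ {u v} → u ≺ v → ¬ v ⪯ u
  ≺⇒⋡ = NonStrictToStrict.<⇒≱ _≡_ _⪯_ ⪯-antisym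

  ⪯∧⋡⇒≺ : ∀ {u v} → u ⪯ v → ¬ v ⪯ u → u ≺ v
  ⪯∧⋡⇒≺ u⪯v v⋠u = u⪯v , λ { refl → v⋠u here }

  ⪯∧⊀⇒≡ : ∀ {u v} → u ⪯ v → ¬ u ≺ v → u ≡ v
  ⪯∧⊀⇒≡ {u} {v} u⪯v u⊀v with u ≟ v
  ... | yes u≡v = u≡v
  ... | no u≢v  = contradiction (u⪯v , u≢v) u⊀v

  edge⇒≺ : ∀ {u v} → Edge E u v → v ≺ u
  edge⇒≺ e = edge⇒⪯ e , λ { refl → dag _ _ e here }

  ≺-wellFounded : WellFounded _≺_
  ≺-wellFounded = spo-wellFounded ≺-isStrictPartialOrder

  -- Kept opaque so that checking the interval models below does not unfold the search.
  opaque
    _⪯?_ : Decidable _⪯_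
    u ⪯? v = search (≺-wellFounded v)
      where
      search : ∀ {v} → Acc _≺_ v → Dec (u ⪯ v)
      search {v} (acc rs) with u ≟ v
      ... | yes refl = yes here
      ... | no u≢v   = map′ (λ (_ , e , p) → there e p)
                            (λ { here → contradiction refl u≢v ; (there e p) → _ , e , p })
                            (any? below-child)
        where
        below-child : ∀ w → Dec (Edge E v w × u ⪯ w)
        below-child w with E v w in e
        ... | false = no λ ()
        ... | true  = map′ (refl ,_) proj₂ (search (rs (edge⇒≺ e)))

  _⪯ᵇ_ : Fin n → Fin n → Bool
  u ⪯ᵇ v = does (u ⪯? v)

  ⪯ᵇ-true : ∀ {u v} → u ⪯ v → (u ⪯ᵇ v) ≡ true
  ⪯ᵇ-true = dec-true (_ ⪯? _)

  ⪯ᵇ-false : ∀ {u v} → ¬ u ⪯ v → (u ⪯ᵇ v) ≡ false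
  ⪯ᵇ-false = dec-false (_ ⪯? _)

  ⪯ᵇ-refl : ∀ u → (u ⪯ᵇ u) ≡ true
  ⪯ᵇ-refl u = ⪯ᵇ-true (here {u = u})

  _≺?_ : Decidable _≺_
  _≺?_ = NonStrictToStrict.<-decidable _≡_ _⪯_ _≟_ _⪯?_

  Minimal : (Fin n → Set) → Fin n → Set
  Minimal P m = P m × (∀ {z} → P z → ¬ z ≺ m)

  Maximal : (Fin n → Set) → Fin n → Set
  Maximal P m = P m × (∀ {z} → P z → ¬ m ≺ z)

  minimal-below : ∀ {P x} → (∀ z → Dec (P z)) → P x → ∃[ m ] (m ⪯ x × Minimal P m)
  minimal-below P? px with ⊏-minimal ≺-wellFounded ≺-trans _≺?_ P? px
  ... | m , pm , inj₁ refl , minimal = m , here , pm , minimal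
  ... | m , pm , inj₂ m≺x , minimal  = m , proj₁ m≺x , pm , minimal

  maximal-above : ∀ {P x} → (∀ z → Dec (P z)) → P x → ∃[ m ] (x ⪯ m × Maximal P m)
  maximal-above P? px
    with ⊏-minimal (spo-noetherian ≺-isStrictPartialOrder) (λ p q → ≺-trans q p) (flip _≺?_) P? px
  ... | m , pm , inj₁ refl , maximal = m , here , pm , maximal
  ... | m , pm , inj₂ x≺m , maximal  = m , proj₁ x≺m , pm , maximal

  maxima-incomparable : ∀ {P x y} → Maximal P x → Maximal P y → x ≢ y → Incomparable E x y
  maxima-incomparable (px , x-max) (py , y-max) x≢y =
    (λ x⪯y → x-max py (x⪯y , x≢y)) , (λ y⪯x → y-max px (y⪯x , x≢y ∘ sym))

  CommonAncestor : Fin n → Fin n → Fin n → Set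
  CommonAncestor x y z = x ⪯ z × y ⪯ z

  CommonDescendant : Fin n → Fin n → Fin n → Set
  CommonDescendant x y z = z ⪯ x × z ⪯ y

  commonAncestor? : ∀ x y z → Dec (CommonAncestor x y z)
  commonAncestor? x y z = x ⪯? z ×-dec y ⪯? z

  commonDescendant? : ∀ x y z → Dec (CommonDescendant x y z)
  commonDescendant? x y z = z ⪯? x ×-dec z ⪯? y

  Between : Fin n → Fin n → Fin n → Fin n → Set
  Between w r₁ r₂ z = w ⪯ z × CommonDescendant r₁ r₂ z

  between? : ∀ w r₁ r₂ z → Dec (Between w r₁ r₂ z)
  between? w r₁ r₂ z = w ⪯? z ×-dec commonDescendant? r₁ r₂ z

  CommonAncestorOf : Subset n → Fin n → Set
  CommonAncestorOf A z = ∀ a → a ∈ A → a ⪯ z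

  commonAncestorOf? : ∀ A z → Dec (CommonAncestorOf A z)
  commonAncestorOf? A z = all? λ b → b ∈? A →-dec b ⪯? z

  minimal⇒LCA : ∀ {A v} → Minimal (CommonAncestorOf A) v → IsLCA E A v
  minimal⇒LCA (v-above , v-min) = v-above , λ w w-above w⪯v → ⪯∧⊀⇒≡ w⪯v (v-min w-above)

  pair-ancestors : ∀ {x y z} → CommonAncestor x y z ⇔ CommonAncestorOf (⁅ x ⁆ ∪ ⁅ y ⁆) z
  pair-ancestors {x} {y} {z} = mk⇔ to-all from-all
    where
    to-all : CommonAncestor x y z → CommonAncestorOf (⁅ x ⁆ ∪ ⁅ y ⁆) z
    to-all (x⪯z , y⪯z) a a∈xy with x∈p∪q⁻ ⁅ x ⁆ ⁅ y ⁆ a∈xy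
    ... | inj₁ a∈x rewrite x∈⁅y⁆⇒x≡y x a∈x = x⪯z
    ... | inj₂ a∈y rewrite x∈⁅y⁆⇒x≡y y a∈y = y⪯z

    from-all : CommonAncestorOf (⁅ x ⁆ ∪ ⁅ y ⁆) z → CommonAncestor x y z
    from-all above = above x (x∈p∪q⁺ (inj₁ (x∈⁅x⁆ x))) , above y (x∈p∪q⁺ (inj₂ (x∈⁅x⁆ y)))

  pair-LCA : ∀ {x y v} → Minimal (CommonAncestor x y) v → IsLCA E (⁅ x ⁆ ∪ ⁅ y ⁆) v
  pair-LCA (v-above , v-min) = minimal⇒LCA (to pair-ancestors v-above , v-min ∘ from pair-ancestors)

  path⇒≺ : ∀ {u v} → Path E u v → v ≺ u
  path⇒≺ [ e ]    = edge⇒≺ e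
  path⇒≺ (e ∷ p) = ≺-trans (path⇒≺ p) (edge⇒≺ e)

  interior⇒between : ∀ {u v z} (p : Path E u v) → Interior p z → v ≺ z × z ≺ u
  interior⇒between (e ∷ p) (inj₁ refl) = path⇒≺ p , edge⇒≺ e
  interior⇒between (e ∷ p) (inj₂ z∈p)  = map₂ (λ z≺w → ≺-trans z≺w (edge⇒≺ e)) (interior⇒between p z∈p)

  ≺⇒path : ∀ {u v} → v ≺ u → Path E u v
  ≺⇒path (here , v≢v)    = contradiction refl v≢v
  ≺⇒path (there e p , _) = ⪯⇒path e p

data SubdividedEdge {m} (S : Digraph m) (x y : Fin m) : Fin (suc m) → Fin (suc m) → Set where
  into-new   : SubdividedEdge S x y (suc x) zero
  out-of-new : SubdividedEdge S x y zero (suc y)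
  kept       : ∀ {a b} → Edge S a b → ¬ (a ≡ x × b ≡ y) → SubdividedEdge S x y (suc a) (suc b)

module _ {m} {S : Digraph m} {x y : Fin m} where

  edge⇒subdivided : ∀ {a b} → Edge (subdivide S x y) a b → SubdividedEdge S x y a b
  edge⇒subdivided {zero} {suc b} e with b ≟ y
  ... | yes refl = out-of-new
  edge⇒subdivided {suc a} {zero} e with a ≟ x
  ... | yes refl = into-new
  edge⇒subdivided {suc a} {suc b} e with S a b in sab | a ≟ x | b ≟ y
  ... | true | no a≢x | _      = kept sab (a≢x ∘ proj₁)
  ... | true | yes _  | no b≢y = kept sab (b≢y ∘ proj₂)

  subdivided⇒edge : ∀ {a b} → SubdividedEdge S x y a b → Edge (subdivide S x y) a b
  subdivided⇒edge into-new with x ≟ x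
  ... | yes _  = refl
  ... | no x≢x = contradiction refl x≢x
  subdivided⇒edge out-of-new with y ≟ y
  ... | yes _  = refl
  ... | no y≢y = contradiction refl y≢y
  subdivided⇒edge (kept {a} {b} e ne) rewrite e with a ≟ x | b ≟ y
  ... | yes a≡x | yes b≡y = contradiction (a≡x , b≡y) ne
  ... | yes _   | no _    = refl
  ... | no _    | _       = refl

  ⪯-subdivide⁺ : ∀ {u v} → u ⪯⟨ S ⟩ v → suc u ⪯⟨ subdivide S x y ⟩ suc v
  ⪯-subdivide⁺ here = here
  ⪯-subdivide⁺ (there {v} {w} e p) with v ≟ x ×-dec w ≟ y
  ... | yes (refl , refl) =
        there {w = zero} (subdivided⇒edge into-new) (there (subdivided⇒edge out-of-new) (⪯-subdivide⁺ p))
  ... | no ne = there (subdivided⇒edge (kept e ne)) (⪯-subdivide⁺ p)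

  new-not-sink : ¬ Sink (subdivide S x y) zero
  new-not-sink sink = sink (suc y) (subdivided⇒edge out-of-new)

  new-not-source : ¬ Source (subdivide S x y) zero
  new-not-source source = source (suc x) (subdivided⇒edge into-new)

  sink-subdivide⁻ : ∀ {a} → Sink (subdivide S x y) (suc a) → Sink S a
  sink-subdivide⁻ {a} sink b e with a ≟ x ×-dec b ≟ y
  ... | yes (refl , refl) = sink zero (subdivided⇒edge into-new)
  ... | no ne             = sink (suc b) (subdivided⇒edge (kept e ne))

  source-subdivide⁻ : ∀ {b} → Source (subdivide S x y) (suc b) → Source S b
  source-subdivide⁻ {b} source a e with a ≟ x ×-dec b ≟ y
  ... | yes (refl , refl) = source zero (subdivided⇒edge out-of-new)
  ... | no ne             = source (suc a) (subdivided⇒edge (kept e ne))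

  sink-subdivide⁺ : Edge S x y → ∀ {a} → Sink S a → Sink (subdivide S x y) (suc a)
  sink-subdivide⁺ exy {a} sink c e with edge⇒subdivided {suc a} {c} e
  ... | into-new  = sink _ exy
  ... | kept e′ _ = sink _ e′

  source-subdivide⁺ : Edge S x y → ∀ {b} → Source S b → Source (subdivide S x y) (suc b)
  source-subdivide⁺ exy {b} source c e with edge⇒subdivided {c} {suc b} e
  ... | out-of-new = source _ exy
  ... | kept e′ _  = source _ e′

module _ {F : Digraph k} where

  ι : ∀ {m S} → Subdiv F m S → Fin k → Fin m
  ι base           = id
  ι (step s _ _ _) = suc ∘ ι s

  ι-injective : ∀ {m S} (s : Subdiv F m S) → Injective _≡_ _≡_ (ι s)
  ι-injective base           = id
  ι-injective (step s _ _ _) = ι-injective s ∘ suc-injective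

  ι-⪯ : ∀ {m S} (s : Subdiv F m S) {a b} → Edge F a b → ι s b ⪯⟨ S ⟩ ι s a
  ι-⪯ base           e = edge⇒⪯ e
  ι-⪯ (step s _ _ _) e = ⪯-subdivide⁺ (ι-⪯ s e)

  ι-sink : ∀ {m S} (s : Subdiv F m S) {x} → Sink F x → Sink S (ι s x)
  ι-sink base           = id
  ι-sink (step s _ _ e) = sink-subdivide⁺ e ∘ ι-sink s

  ι-source : ∀ {m S} (s : Subdiv F m S) {x} → Source F x → Source S (ι s x)
  ι-source base           = id
  ι-source (step s _ _ e) = source-subdivide⁺ e ∘ ι-source s

  sink⇒ι : ∀ {m S} (s : Subdiv F m S) {a} → Sink S a → ∃[ x ] (Sink F x × ι s x ≡ a)
  sink⇒ι base                   sink = _ , sink , refl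
  sink⇒ι (step s _ _ _) {zero}  sink = ⊥-elim (new-not-sink sink)
  sink⇒ι (step s _ _ _) {suc a} sink = map₂ (map₂ (cong suc)) (sink⇒ι s (sink-subdivide⁻ sink))

  source⇒ι : ∀ {m S} (s : Subdiv F m S) {a} → Source S a → ∃[ x ] (Source F x × ι s x ≡ a)
  source⇒ι base                   source = _ , source , refl
  source⇒ι (step s _ _ _) {zero}  source = ⊥-elim (new-not-source source)
  source⇒ι (step s _ _ _) {suc a} source = map₂ (map₂ (cong suc)) (source⇒ι s (source-subdivide⁻ source))

module _ {F : Digraph k} {G : Digraph n} where

  branch : FSubdivision F G → Fin k → Fin n
  branch H = f (emb H) ∘ ι (isSub H)

  embedding-⪯ : ∀ {m} {S : Digraph m} (em : Embedding G S) {a b} → a ⪯⟨ S ⟩ b → f em a ⪯⟨ G ⟩ f em b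
  embedding-⪯ em here        = here
  embedding-⪯ em (there e p) = there (edge-pres em _ _ e) (embedding-⪯ em p)

  branch-⪯ : (H : FSubdivision F G) {a b : Fin k} → Edge F a b → branch H b ⪯⟨ G ⟩ branch H a
  branch-⪯ H e = embedding-⪯ (emb H) (ι-⪯ (isSub H) e)

  branch-injective : (H : FSubdivision F G) → Injective _≡_ _≡_ (branch H)
  branch-injective H = ι-injective (isSub H) ∘ inj (emb H)

  module _ (dag : IsDAG G) (H : FSubdivision F G) where

    private
      loopless : Loopless (S H)
      loopless a e = dag _ _ (edge-pres (emb H) a a e) here

    InL⇔sink-branch : ∀ v → InL H v ⇔ (∃[ x ] (Sink F x × branch H x ≡ v))
    InL⇔sink-branch v = mk⇔
      (λ { (a , refl , leaf) →
           map₂ (map₂ (cong (f (emb H)))) (sink⇒ι (isSub H) (leaf⇒sink loopless leaf)) })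
      (λ { (x , sink , refl) → ι (isSub H) x , refl , sink⇒leaf (ι-sink (isSub H) sink) })

    InR⇔source-branch : ∀ v → InR H v ⇔ (∃[ x ] (Source F x × branch H x ≡ v))
    InR⇔source-branch v = mk⇔
      (λ { (a , refl , root) →
           map₂ (map₂ (cong (f (emb H)))) (source⇒ι (isSub H) (root⇒source loopless root)) })
      (λ { (x , source , refl) → ι (isSub H) x , refl , source⇒root (ι-source (isSub H) source) })

on-pair : ∀ {A : Set} {P : A → Set} {a b v} → v ≡ a ⊎ v ≡ b → P a → P b → P v
on-pair (inj₁ refl) pa _ = pa
on-pair (inj₂ refl) _ pb = pb

image-of-pair : ∀ {A B : Set} {P : A → Set} {h g : A → B} {a b} → h ≗ g →
                (∀ x → P x ⇔ (x ≡ a ⊎ x ≡ b)) → ∀ v → (∃[ x ] (P x × h x ≡ v)) ⇔ (v ≡ g a ⊎ v ≡ g b)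
image-of-pair {P = P} {h} {g} {a} {b} h≗g P⇔pair v = mk⇔ image⇒pair pair⇒image
  where
  image⇒pair : ∃[ x ] (P x × h x ≡ v) → v ≡ g a ⊎ v ≡ g b
  image⇒pair (x , px , refl) with to (P⇔pair x) px
  ... | inj₁ refl = inj₁ (h≗g a)
  ... | inj₂ refl = inj₂ (h≗g b)

  pair⇒image : v ≡ g a ⊎ v ≡ g b → ∃[ x ] (P x × h x ≡ v)
  pair⇒image (inj₁ refl) = a , from (P⇔pair a) (inj₁ refl) , h≗g a
  pair⇒image (inj₂ refl) = b , from (P⇔pair b) (inj₂ refl) , h≗g b

SourcesSinks : Digraph k → (r₁ r₂ l₁ l₂ : Fin k) → Set
SourcesSinks F r₁ r₂ l₁ l₂ =
  (∀ x → Source F x ⇔ (x ≡ r₁ ⊎ x ≡ r₂)) × (∀ x → Sink F x ⇔ (x ≡ l₁ ⊎ x ≡ l₂))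

record RootsLeaves {F : Digraph k} {G : Digraph n} (H : FSubdivision F G) (r₁ r₂ l₁ l₂ : Fin n) : Set where
  constructor rootsLeaves-intro
  field
    roots  : ∀ v → InR H v ⇔ (v ≡ r₁ ⊎ v ≡ r₂)
    leaves : ∀ v → InL H v ⇔ (v ≡ l₁ ⊎ v ≡ l₂)

open RootsLeaves using (roots; leaves)

module _ {F : Digraph k} {G : Digraph n} where

  branch-rootsLeaves : IsDAG G → ∀ {r₁ r₂ l₁ l₂} → SourcesSinks F r₁ r₂ l₁ l₂ →
                       (H : FSubdivision F G) → ∀ {g} → branch H ≗ g →
                       RootsLeaves H (g r₁) (g r₂) (g l₁) (g l₂)
  branch-rootsLeaves dag (sources , sinks) H branch≗g = rootsLeaves-intro
    (λ v → ⇔.trans (InR⇔source-branch dag H v) (image-of-pair branch≗g sources v))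
    (λ v → ⇔.trans (InL⇔sink-branch dag H v) (image-of-pair branch≗g sinks v))

  sameLR : ∀ {k′} {F′ : Digraph k′} {H : FSubdivision F G} {H′ : FSubdivision F′ G} {r₁ r₂ l₁ l₂} →
           RootsLeaves H r₁ r₂ l₁ l₂ → RootsLeaves H′ r₁ r₂ l₁ l₂ → SameLR H H′
  sameLR (rootsLeaves-intro R L) (rootsLeaves-intro R′ L′) =
    (λ v → via (L′ v) (L v) , via (L v) (L′ v)) , (λ v → via (R′ v) (R v) , via (R v) (R′ v))
    where
    via : ∀ {A B C : Set} → A ⇔ C → B ⇔ C → A → B
    via A⇔C B⇔C = from B⇔C ∘ to A⇔C

  record Centre (H : FSubdivision F G) (c : Fin n) : Set where
    constructor centre-intro
    field
      below-roots  : ∀ v → InR H v → c ⪯⟨ G ⟩ v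
      above-leaves : ∀ v → InL H v → v ⪯⟨ G ⟩ c

  centre : ∀ {H : FSubdivision F G} {r₁ r₂ l₁ l₂ c} → RootsLeaves H r₁ r₂ l₁ l₂ →
           c ⪯⟨ G ⟩ r₁ → c ⪯⟨ G ⟩ r₂ → l₁ ⪯⟨ G ⟩ c → l₂ ⪯⟨ G ⟩ c → Centre H c
  centre (rootsLeaves-intro R L) c⪯r₁ c⪯r₂ l₁⪯c l₂⪯c = centre-intro
    (λ v v∈R → on-pair (to (R v) v∈R) c⪯r₁ c⪯r₂) (λ v v∈L → on-pair (to (L v) v∈L) l₁⪯c l₂⪯c)

  centre-bounds : ∀ {H : FSubdivision F G} {r₁ r₂ l₁ l₂ c} → RootsLeaves H r₁ r₂ l₁ l₂ → Centre H c →
                  (c ⪯⟨ G ⟩ r₁ × c ⪯⟨ G ⟩ r₂) × (l₁ ⪯⟨ G ⟩ c × l₂ ⪯⟨ G ⟩ c)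
  centre-bounds {r₁ = r₁} {r₂} {l₁} {l₂} (rootsLeaves-intro R L) (centre-intro below-roots above-leaves) =
    (below-roots r₁ (from (R r₁) (inj₁ refl)) , below-roots r₂ (from (R r₂) (inj₂ refl))) ,
    (above-leaves l₁ (from (L l₁) (inj₁ refl)) , above-leaves l₂ (from (L l₂) (inj₂ refl)))

centre-transport : ∀ {k′} {F : Digraph k} {F′ : Digraph k′} {G : Digraph n}
                   {H : FSubdivision F G} {H′ : FSubdivision F′ G} {c} →
                   SameLR H H′ → Centre H′ c → Centre H c
centre-transport (L , R) (centre-intro below-roots above-leaves) =
  centre-intro (λ v → below-roots v ∘ proj₂ (R v)) (λ v → above-leaves v ∘ proj₂ (L v))

module _ {G : Digraph n} where

  pair-incomparable : ∀ {a b u v} → Incomparable G a b → u ≡ a ⊎ u ≡ b → v ≡ a ⊎ v ≡ b → u ≢ v →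
                      Incomparable G u v
  pair-incomparable _             (inj₁ refl) (inj₁ refl) u≢v = contradiction refl u≢v
  pair-incomparable a∥b           (inj₁ refl) (inj₂ refl) _   = a∥b
  pair-incomparable (a⋠b , b⋠a)   (inj₂ refl) (inj₁ refl) _   = b⋠a , a⋠b
  pair-incomparable _             (inj₂ refl) (inj₂ refl) u≢v = contradiction refl u≢v

  strict : ∀ {H : FSubdivision K22 G} {r₁ r₂ l₁ l₂} → RootsLeaves H r₁ r₂ l₁ l₂ →
           Incomparable G r₁ r₂ → Incomparable G l₁ l₂ → IsStrict H
  strict (rootsLeaves-intro R L) r₁∥r₂ l₁∥l₂ =
    (λ u v u∈R v∈R → pair-incomparable r₁∥r₂ (to (R u) u∈R) (to (R v) v∈R)) ,
    (λ u v u∈L v∈L → pair-incomparable l₁∥l₂ (to (L u) u∈L) (to (L v) v∈L))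

pattern 𝟘 = zero
pattern 𝟙 = suc 𝟘
pattern 𝟚 = suc 𝟙
pattern 𝟛 = suc 𝟚
pattern 𝟜 = suc 𝟛
pattern 𝟝 = suc 𝟜

sourcesSinks? : (F : Digraph k) (r₁ r₂ l₁ l₂ : Fin k) → Dec (SourcesSinks F r₁ r₂ l₁ l₂)
sourcesSinks? F r₁ r₂ l₁ l₂ =
  all? (λ x → source? x ⇔? (x ≟ r₁ ⊎-dec x ≟ r₂)) ×-dec all? (λ x → sink? x ⇔? (x ≟ l₁ ⊎-dec x ≟ l₂))
  where
  source? : ∀ x → Dec (Source F x)
  source? x = all? λ y → ¬? (F y x ≟ᵇ true)

  sink? : ∀ x → Dec (Sink F x)
  sink? x = all? λ y → ¬? (F x y ≟ᵇ true)

  _⇔?_ : ∀ {A B : Set} → Dec A → Dec B → Dec (A ⇔ B)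
  a? ⇔? b? = map′ (λ (ab , ba) → mk⇔ ab ba) (λ a⇔b → to a⇔b , from a⇔b) ((a? →-dec b?) ×-dec (b? →-dec a?))

K22-sourcesSinks : SourcesSinks K22 𝟘 𝟙 𝟚 𝟛
K22-sourcesSinks = from-yes (sourcesSinks? K22 𝟘 𝟙 𝟚 𝟛)

X-sourcesSinks : SourcesSinks X 𝟘 𝟙 𝟛 𝟜
X-sourcesSinks = from-yes (sourcesSinks? X 𝟘 𝟙 𝟛 𝟜)

X′-sourcesSinks : SourcesSinks X' 𝟘 𝟙 𝟜 𝟝
X′-sourcesSinks = from-yes (sourcesSinks? X' 𝟘 𝟙 𝟜 𝟝)

module _ {G : Digraph n} (dag : IsDAG G) where

  X-centre : (H : FSubdivision X G) → Centre H (branch H 𝟚)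
  X-centre H = centre (branch-rootsLeaves dag X-sourcesSinks H (λ _ → refl))
    (branch-⪯ H {𝟘} {𝟚} refl) (branch-⪯ H {𝟙} {𝟚} refl)
    (branch-⪯ H {𝟚} {𝟛} refl) (branch-⪯ H {𝟚} {𝟜} refl)

  X′-centre : (H : FSubdivision X' G) → Centre H (branch H 𝟚)
  X′-centre H = centre (branch-rootsLeaves dag X′-sourcesSinks H (λ _ → refl))
    (branch-⪯ H {𝟘} {𝟚} refl) (branch-⪯ H {𝟙} {𝟚} refl)
    (⪯-trans (branch-⪯ H {𝟛} {𝟜} refl) (branch-⪯ H {𝟚} {𝟛} refl))
    (⪯-trans (branch-⪯ H {𝟛} {𝟝} refl) (branch-⪯ H {𝟚} {𝟛} refl))

  xcondition-centre : XCondition G → (H : FSubdivision K22 G) → IsStrict H → ∃ (Centre H)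
  xcondition-centre xc H H-strict with xc H H-strict
  ... | inj₁ (H′ , same) = _ , centre-transport same (X-centre H′)
  ... | inj₂ (H′ , same) = _ , centre-transport same (X′-centre H′)

data Cell (k : ℕ) : Set where
  node : Fin k → Cell k
  arc  : Fin k → Fin k → Cell k

node-injective : ∀ {c c′ : Fin k} → node c ≡ node c′ → c ≡ c′
node-injective refl = refl

arc-injective : ∀ {a b a′ b′ : Fin k} → arc a b ≡ arc a′ b′ → (a , b) ≡ (a′ , b′)
arc-injective refl = refl

node≢arc : ∀ {c a b : Fin k} → node c ≢ arc a b
node≢arc ()

all-or : ∀ {A : Fin n → Set} {B : Set} → (∀ i → A i ⊎ B) → (∀ i → A i) ⊎ B
all-or {zero}  _ = inj₁ λ ()
all-or {suc n} h with h zero | all-or (h ∘ suc)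
... | inj₂ b | _       = inj₂ b
... | inj₁ _ | inj₂ b  = inj₂ b
... | inj₁ a | inj₁ as = inj₁ λ { zero → a ; (suc i) → as i }

module Realisation {G : Digraph n} (dag : IsDAG G) where
  open Order dag

  CellInterval : (Fin n → Cell k) → (top bottom : Fin n) → Cell k → Set
  CellInterval cell top bottom label = bottom ≺ top × (∀ {z} → bottom ≺ z → z ≺ top → cell z ≡ label)

  record IntervalModel (F : Digraph k) (g : Fin k → Fin n) : Set where
    field
      cell         : Fin n → Cell k
      cell-node    : ∀ c → cell (g c) ≡ node c
      arc-interval : ∀ {a b} → Edge F a b → CellInterval cell (g a) (g b) (arc a b)

  module Construction {F : Digraph k} {g : Fin k → Fin n} (model : IntervalModel F g) where
    open IntervalModel model

    record Partial : Set where
      field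
        size            : ℕ
        shape           : Digraph size
        subdiv          : Subdiv F size shape
        place           : Fin size → Fin n
        place-injective : Injective _≡_ _≡_ place
        place-ι         : ∀ x → place (ι subdiv x) ≡ g x
        route           : ∀ {a b} → Edge shape a b → Path G (place a) (place b)
        route-avoids    : ∀ {a b} (e : Edge shape a b) c → ¬ Interior (route e) (place c)
        routes-disjoint : ∀ {a b a′ b′} (e : Edge shape a b) (e′ : Edge shape a′ b′) {z} →
                          Interior (route e) z → Interior (route e′) z → (a , b) ≡ (a′ , b′)

    initial : Partial
    initial = record
      { size = k ; shape = F ; subdiv = base ; place = g ; place-injective = g-injective
      ; place-ι = λ _ → refl ; route = route₀ ; route-avoids = avoids₀ ; routes-disjoint = disjoint₀
      }
      where
      g-injective : Injective _≡_ _≡_ g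
      g-injective {c} {c′} gc≡gc′ =
        node-injective (trans (sym (cell-node c)) (trans (cong cell gc≡gc′) (cell-node c′)))

      route₀ : ∀ {a b} → Edge F a b → Path G (g a) (g b)
      route₀ e = ≺⇒path (proj₁ (arc-interval e))

      interior-cell : ∀ {a b z} (e : Edge F a b) → Interior (route₀ e) z → cell z ≡ arc a b
      interior-cell e z∈e = let (b≺z , z≺a) = interior⇒between (route₀ e) z∈e in
                            proj₂ (arc-interval e) b≺z z≺a

      avoids₀ : ∀ {a b} (e : Edge F a b) c → ¬ Interior (route₀ e) (g c)
      avoids₀ e c gc∈e = node≢arc (trans (sym (cell-node c)) (interior-cell e gc∈e))

      disjoint₀ : ∀ {a b a′ b′} (e : Edge F a b) (e′ : Edge F a′ b′) {z} →
                  Interior (route₀ e) z → Interior (route₀ e′) z → (a , b) ≡ (a′ , b′)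
      disjoint₀ e e′ z∈e z∈e′ = arc-injective (trans (sym (interior-cell e z∈e)) (interior-cell e′ z∈e′))

    record Detour (P : Partial) : Set where
      open Partial P
      field
        {c d}  : Fin size
        long   : Edge shape c d
        {w}    : Fin n
        first  : Edge G (place c) w
        rest   : Path G w (place d)
        route≡ : route long ≡ first ∷ rest

    Direct : Partial → Set
    Direct P = ∀ {a b} → Edge shape a b → Edge G (place a) (place b)
      where open Partial P

    direct-or-detour : (P : Partial) → Direct P ⊎ Detour P
    direct-or-detour P = map₁ (λ direct {a} {b} → direct a b) (all-or λ a → all-or λ b → at a b)
      where
      open Partial P
      at : ∀ a b → (Edge shape a b → Edge G (place a) (place b)) ⊎ Detour P
      at a b with shape a b in e
      ... | false = inj₁ λ ()
      ... | true with route e in route≡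
      ...   | [ direct ]   = inj₁ λ _ → direct
      ...   | first ∷ rest = inj₂ (record { long = e ; first = first ; rest = rest ; route≡ = route≡ })

    module Extension (P : Partial) (D : Detour P) where
      open Partial P
      open Detour D

      w∈long : Interior (route long) w
      w∈long rewrite route≡ = inj₁ refl

      rest⊆long : ∀ {z} → Interior rest z → Interior (route long) z
      rest⊆long z∈rest rewrite route≡ = inj₂ z∈rest

      place′ : Fin (suc size) → Fin n
      place′ zero    = w
      place′ (suc a) = place a

      place′-injective : Injective _≡_ _≡_ place′
      place′-injective {zero}  {zero}  _   = refl
      place′-injective {zero}  {suc b} w≡b =
        ⊥-elim (route-avoids long b (subst (Interior (route long)) w≡b w∈long))
      place′-injective {suc a} {zero}  a≡w =
        ⊥-elim (route-avoids long a (subst (Interior (route long)) (sym a≡w) w∈long))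
      place′-injective {suc a} {suc b} a≡b = cong suc (place-injective a≡b)

      route′ : ∀ {a b} → SubdividedEdge shape c d a b → Path G (place′ a) (place′ b)
      route′ into-new   = [ first ]
      route′ out-of-new = rest
      route′ (kept e _) = route e

      avoids′ : ∀ {a b} (v : SubdividedEdge shape c d a b) x → ¬ Interior (route′ v) (place′ x)
      avoids′ into-new       _       ()
      avoids′ out-of-new     zero    w∈rest = ≺-irrefl refl (proj₂ (interior⇒between rest w∈rest))
      avoids′ out-of-new     (suc x) x∈rest = route-avoids long x (rest⊆long x∈rest)
      avoids′ (kept e ab≢cd) zero    w∈e    = ab≢cd (,-injective (routes-disjoint e long w∈e w∈long))
      avoids′ (kept e _)     (suc x) x∈e    = route-avoids e x x∈e

      disjoint′ : ∀ {a b a′ b′} (v : SubdividedEdge shape c d a b) (v′ : SubdividedEdge shape c d a′ b′) {z} →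
                  Interior (route′ v) z → Interior (route′ v′) z → (a , b) ≡ (a′ , b′)
      disjoint′ into-new       _              ()  _
      disjoint′ _              into-new       _   ()
      disjoint′ out-of-new     out-of-new     _   _   = refl
      disjoint′ out-of-new     (kept e ab≢cd) z∈r z∈e =
        contradiction (,-injective (routes-disjoint e long z∈e (rest⊆long z∈r))) ab≢cd
      disjoint′ (kept e ab≢cd) out-of-new     z∈e z∈r =
        contradiction (,-injective (routes-disjoint e long z∈e (rest⊆long z∈r))) ab≢cd
      disjoint′ (kept e _)     (kept e′ _)    z∈e z∈e′ =
        cong (λ (a , b) → suc a , suc b) (routes-disjoint e e′ z∈e z∈e′)

      extended : Partial
      extended = record
        { size = suc size ; shape = subdivide shape c d ; subdiv = step subdiv c d long
        ; place = place′ ; place-injective = place′-injective ; place-ι = place-ι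
        ; route = λ {a} {b} e → route′ (edge⇒subdivided {a = a} {b} e)
        ; route-avoids = λ {a} {b} e → avoids′ (edge⇒subdivided {a = a} {b} e)
        ; routes-disjoint = λ {a} {b} {a′} {b′} e e′ →
            disjoint′ (edge⇒subdivided {a = a} {b} e) (edge⇒subdivided {a = a′} {b′} e′)
        }

    embed : (P : Partial) → Direct P → Σ (FSubdivision F G) λ H → branch H ≗ g
    embed P direct = H , place-ι
      where
      open Partial P
      H : FSubdivision F G
      H = record { m = size ; S = shape ; isSub = subdiv
                 ; emb = record { f = place ; inj = place-injective ; edge-pres = λ _ _ → direct } }

    -- Every extension adds a vertex that is placed injectively into Fin n, so a budget of n suffices.
    complete : ∀ budget (P : Partial) → n ≤ budget + Partial.size P →
               Σ (FSubdivision F G) λ H → branch H ≗ g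
    complete budget P n≤ with direct-or-detour P
    ... | inj₁ direct = embed P direct
    ... | inj₂ D with budget
    ...   | zero =
            contradiction (≤-trans (injective⇒≤ (Partial.place-injective (Extension.extended P D))) n≤)
                          (<-irrefl refl)
    ...   | suc budget′ = complete budget′ (Extension.extended P D) (subst (n ≤_) (sym (+-suc budget′ _)) n≤)

  realise : ∀ {F : Digraph k} {g} → IntervalModel F g → Σ (FSubdivision F G) λ H → branch H ≗ g
  realise model = complete n initial (m≤m+n n _)
    where open Construction model

module _ {N : Digraph n} (dag : IsDAG N) where
  open Order dag
  open Realisation dag

  module K22Shape {v₁ v₂ l₁ l₂ u₁ u₂ : Fin n}
    (l₁-max : Maximal (CommonDescendant v₁ v₂) l₁) (l₂-max : Maximal (CommonDescendant v₁ v₂) l₂)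
    (l₁≢l₂ : l₁ ≢ l₂)
    (u₁-min : Minimal (CommonAncestor l₁ l₂) u₁) (u₁⪯v₁ : u₁ ⪯ v₁)
    (u₂-min : Minimal (CommonAncestor l₁ l₂) u₂) (u₂⪯v₂ : u₂ ⪯ v₂) where

    l₁⪯v₁ : l₁ ⪯ v₁
    l₁⪯v₁ = proj₁ (proj₁ l₁-max)

    l₂⪯v₁ : l₂ ⪯ v₁
    l₂⪯v₁ = proj₁ (proj₁ l₂-max)

    u₁-above : CommonAncestor l₁ l₂ u₁
    u₁-above = proj₁ u₁-min

    u₂-above : CommonAncestor l₁ l₂ u₂
    u₂-above = proj₁ u₂-min

    l₁∥l₂ : Incomparable N l₁ l₂
    l₁∥l₂ = maxima-incomparable l₁-max l₂-max l₁≢l₂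

    no-ancestor-below : ∀ {z} → CommonDescendant v₁ v₂ z → ¬ CommonAncestor l₁ l₂ z
    no-ancestor-below z-below (l₁⪯z , l₂⪯z) with ⪯∧⊀⇒≡ l₁⪯z (proj₂ l₁-max z-below)
    ... | refl = proj₂ l₁∥l₂ l₂⪯z

    u₁∥u₂ : Incomparable N u₁ u₂
    u₁∥u₂ = (λ u₁⪯u₂ → no-ancestor-below (u₁⪯v₁ , ⪯-trans u₁⪯u₂ u₂⪯v₂) u₁-above)
          , (λ u₂⪯u₁ → no-ancestor-below (⪯-trans u₂⪯u₁ u₁⪯v₁ , u₂⪯v₂) u₂-above)

    u₂⋠v₁ : ¬ u₂ ⪯ v₁
    u₂⋠v₁ u₂⪯v₁ = no-ancestor-below (u₂⪯v₁ , u₂⪯v₂) u₂-above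

    ancestor⋠l₁ : ∀ {z} → CommonAncestor l₁ l₂ z → ¬ z ⪯ l₁
    ancestor⋠l₁ (_ , l₂⪯z) z⪯l₁ = proj₂ l₁∥l₂ (⪯-trans l₂⪯z z⪯l₁)

    ancestor⋠l₂ : ∀ {z} → CommonAncestor l₁ l₂ z → ¬ z ⪯ l₂
    ancestor⋠l₂ (l₁⪯z , _) z⪯l₂ = proj₁ l₁∥l₂ (⪯-trans l₁⪯z z⪯l₂)

    below-u₁ : ∀ {z} → z ≺ u₁ → ¬ CommonAncestor l₁ l₂ z
    below-u₁ z≺u₁ z-above = proj₂ u₁-min z-above z≺u₁

    below-u₂ : ∀ {z} → z ≺ u₂ → ¬ CommonAncestor l₁ l₂ z
    below-u₂ z≺u₂ z-above = proj₂ u₂-min z-above z≺u₂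

    corners : Fin 4 → Fin n
    corners = lookup (u₁ ∷ u₂ ∷ l₁ ∷ l₂ ∷ [])

    cell : Fin n → Cell 4
    cell z = if l₁ ⪯ᵇ z
      then (if l₂ ⪯ᵇ z then (if z ⪯ᵇ v₁ then node 𝟘 else node 𝟙)
            else if z ⪯ᵇ v₁ then (if z ⪯ᵇ l₁ then node 𝟚 else arc 𝟘 𝟚)
            else arc 𝟙 𝟚)
      else (if z ⪯ᵇ v₁ then (if z ⪯ᵇ l₂ then node 𝟛 else arc 𝟘 𝟛) else arc 𝟙 𝟛)

    cell-node : ∀ c → cell (corners c) ≡ node c
    cell-node 𝟘 rewrite ⪯ᵇ-true (proj₁ u₁-above) | ⪯ᵇ-true (proj₂ u₁-above) | ⪯ᵇ-true u₁⪯v₁ = refl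
    cell-node 𝟙 rewrite ⪯ᵇ-true (proj₁ u₂-above) | ⪯ᵇ-true (proj₂ u₂-above) | ⪯ᵇ-false u₂⋠v₁ = refl
    cell-node 𝟚 rewrite ⪯ᵇ-refl l₁ | ⪯ᵇ-false (proj₂ l₁∥l₂) | ⪯ᵇ-true l₁⪯v₁ = refl
    cell-node 𝟛 rewrite ⪯ᵇ-false (proj₁ l₁∥l₂) | ⪯ᵇ-true l₂⪯v₁ | ⪯ᵇ-refl l₂ = refl

    cell-u₁l₁ : ∀ {z} → l₁ ≺ z → z ≺ u₁ → cell z ≡ arc 𝟘 𝟚
    cell-u₁l₁ l₁≺z z≺u₁
      rewrite ⪯ᵇ-true (proj₁ l₁≺z) | ⪯ᵇ-false (λ l₂⪯z → below-u₁ z≺u₁ (proj₁ l₁≺z , l₂⪯z))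
            | ⪯ᵇ-true (⪯-trans (proj₁ z≺u₁) u₁⪯v₁) | ⪯ᵇ-false (≺⇒⋡ l₁≺z) = refl

    cell-u₂l₁ : ∀ {z} → l₁ ≺ z → z ≺ u₂ → cell z ≡ arc 𝟙 𝟚
    cell-u₂l₁ l₁≺z z≺u₂
      rewrite ⪯ᵇ-true (proj₁ l₁≺z) | ⪯ᵇ-false (λ l₂⪯z → below-u₂ z≺u₂ (proj₁ l₁≺z , l₂⪯z))
            | ⪯ᵇ-false (λ z⪯v₁ → proj₂ l₁-max (z⪯v₁ , ⪯-trans (proj₁ z≺u₂) u₂⪯v₂) l₁≺z) = refl

    cell-u₁l₂ : ∀ {z} → l₂ ≺ z → z ≺ u₁ → cell z ≡ arc 𝟘 𝟛
    cell-u₁l₂ l₂≺z z≺u₁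
      rewrite ⪯ᵇ-false (λ l₁⪯z → below-u₁ z≺u₁ (l₁⪯z , proj₁ l₂≺z))
            | ⪯ᵇ-true (⪯-trans (proj₁ z≺u₁) u₁⪯v₁) | ⪯ᵇ-false (≺⇒⋡ l₂≺z) = refl

    cell-u₂l₂ : ∀ {z} → l₂ ≺ z → z ≺ u₂ → cell z ≡ arc 𝟙 𝟛
    cell-u₂l₂ l₂≺z z≺u₂
      rewrite ⪯ᵇ-false (λ l₁⪯z → below-u₂ z≺u₂ (l₁⪯z , proj₁ l₂≺z))
            | ⪯ᵇ-false (λ z⪯v₁ → proj₂ l₂-max (z⪯v₁ , ⪯-trans (proj₁ z≺u₂) u₂⪯v₂) l₂≺z) = refl

    arc-interval : ∀ {a b} → Edge K22 a b → CellInterval cell (corners a) (corners b) (arc a b)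
    arc-interval {𝟘} {𝟚} _ = ⪯∧⋡⇒≺ (proj₁ u₁-above) (ancestor⋠l₁ u₁-above) , cell-u₁l₁
    arc-interval {𝟘} {𝟛} _ = ⪯∧⋡⇒≺ (proj₂ u₁-above) (ancestor⋠l₂ u₁-above) , cell-u₁l₂
    arc-interval {𝟙} {𝟚} _ = ⪯∧⋡⇒≺ (proj₁ u₂-above) (ancestor⋠l₁ u₂-above) , cell-u₂l₁
    arc-interval {𝟙} {𝟛} _ = ⪯∧⋡⇒≺ (proj₂ u₂-above) (ancestor⋠l₂ u₂-above) , cell-u₂l₂

    model : IntervalModel K22 corners
    model = record { cell = cell ; cell-node = cell-node ; arc-interval = arc-interval }

    refutes-XCondition : ¬ XCondition N
    refutes-XCondition xc with realise model
    ... | H , branch≗corners with branch-rootsLeaves dag K22-sourcesSinks H branch≗corners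
    ... | H-rl with xcondition-centre dag xc H (strict H-rl u₁∥u₂ l₁∥l₂)
    ... | c , c-centre with centre-bounds H-rl c-centre
    ... | (c⪯u₁ , c⪯u₂) , c-above = no-ancestor-below (⪯-trans c⪯u₁ u₁⪯v₁ , ⪯-trans c⪯u₂ u₂⪯v₂) c-above

  below-both-LCAs : ∀ {A v₁ v₂ a} → IsLCA N A v₁ → IsLCA N A v₂ → a ∈ A → CommonDescendant v₁ v₂ a
  below-both-LCAs v₁-lca v₂-lca a∈A = proj₁ v₁-lca _ a∈A , proj₁ v₂-lca _ a∈A

  escapee : ∀ {A v₁ v₂ l} → IsLCA N A v₁ → IsLCA N A v₂ → v₁ ≢ v₂ → CommonDescendant v₁ v₂ l →
            ∃[ b ] (b ∈ A × ¬ b ⪯ l)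
  escapee {A} {l = l} v₁-lca v₂-lca v₁≢v₂ (l⪯v₁ , l⪯v₂) with any? (λ b → b ∈? A ×-dec ¬? (b ⪯? l))
  ... | yes found   = found
  ... | no ∄escapee =
        contradiction (trans (sym (proj₂ v₁-lca l l-above l⪯v₁)) (proj₂ v₂-lca l l-above l⪯v₂)) v₁≢v₂
    where
    l-above : CommonAncestorOf A l
    l-above b b∈A = decidable-stable (b ⪯? l) (λ b⋠l → ∄escapee (b , b∈A , b⋠l))

  distinct-LCAs-refute : ∀ {A v₁ v₂ a} → IsLCA N A v₁ → IsLCA N A v₂ → v₁ ≢ v₂ → a ∈ A →
                         ¬ XCondition N
  distinct-LCAs-refute {A} {v₁} {v₂} v₁-lca v₂-lca v₁≢v₂ a∈A
    with maximal-above (commonDescendant? v₁ v₂) (below-both-LCAs v₁-lca v₂-lca a∈A)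
  ... | l₁ , _ , l₁-max with escapee v₁-lca v₂-lca v₁≢v₂ (proj₁ l₁-max)
  ... | b , b∈A , b⋠l₁ with maximal-above (commonDescendant? v₁ v₂) (below-both-LCAs v₁-lca v₂-lca b∈A)
  ... | l₂ , b⪯l₂ , l₂-max
    with minimal-below (commonAncestor? l₁ l₂) (proj₁ (proj₁ l₁-max) , proj₁ (proj₁ l₂-max))
       | minimal-below (commonAncestor? l₁ l₂) (proj₂ (proj₁ l₁-max) , proj₂ (proj₁ l₂-max))
  ... | u₁ , u₁⪯v₁ , u₁-min | u₂ , u₂⪯v₂ , u₂-min =
    K22Shape.refutes-XCondition l₁-max l₂-max (λ { refl → b⋠l₁ b⪯l₂ }) u₁-min u₁⪯v₁ u₂-min u₂⪯v₂

module _ {N : Digraph n} (net : IsNetwork N) where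
  open Order (proj₁ net)

  below-root : ∀ x → x ⪯ proj₁ (proj₂ net)
  below-root x with maximal-above {P = λ _ → ⊤} {x} (λ _ → yes tt) tt
  ... | m , x⪯m , _ , m-max = subst (x ⪯_) (proj₂ (proj₂ (proj₂ net)) m m-root) x⪯m
    where
    m-root : IsRoot N m
    m-root b m⪯b = sym (⪯∧⊀⇒≡ m⪯b (m-max tt))

  xcondition⇒globalLCA : XCondition N → GlobalLCA N
  xcondition⇒globalLCA xc A (a , a∈A) with minimal-below (commonAncestorOf? A) (λ b _ → below-root b)
  ... | v , _ , v-min = v , v-lca , λ w w-lca →
          decidable-stable (w ≟ v) (λ w≢v → distinct-LCAs-refute (proj₁ net) w-lca v-lca w≢v a∈A xc)
    where
    v-lca : IsLCA N A v
    v-lca = minimal⇒LCA v-min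

module _ {N : Digraph n} (dag : IsDAG N) where
  open Order dag
  open Realisation dag

  realise-sameLR : ∀ {k₀ k} {F₀ : Digraph k₀} {F : Digraph k} {H : FSubdivision F₀ N}
                     {g : Fin k → Fin n} {s₁ s₂ t₁ t₂} → SourcesSinks F s₁ s₂ t₁ t₂ →
                   IntervalModel F g → RootsLeaves H (g s₁) (g s₂) (g t₁) (g t₂) →
                   Σ (FSubdivision F N) (SameLR H)
  realise-sameLR sources-sinks model H-rl with realise model
  ... | H′ , branch≗g = H′ , sameLR H-rl (branch-rootsLeaves dag sources-sinks H′ branch≗g)

  module XShape {r₁ r₂ u w l₁ l₂ : Fin n}
    (r₁∥r₂ : Incomparable N r₁ r₂) (l₁∥l₂ : Incomparable N l₁ l₂)
    (w-min : Minimal (CommonAncestor l₁ l₂) w) (u-max : Maximal (Between w r₁ r₂) u) where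

    w⪯u : w ⪯ u
    w⪯u = proj₁ (proj₁ u-max)

    u⪯r₁ : u ⪯ r₁
    u⪯r₁ = proj₁ (proj₂ (proj₁ u-max))

    u⪯r₂ : u ⪯ r₂
    u⪯r₂ = proj₂ (proj₂ (proj₁ u-max))

    w⪯r₁ : w ⪯ r₁
    w⪯r₁ = ⪯-trans w⪯u u⪯r₁

    w⪯r₂ : w ⪯ r₂
    w⪯r₂ = ⪯-trans w⪯u u⪯r₂

    l₁⪯w : l₁ ⪯ w
    l₁⪯w = proj₁ (proj₁ w-min)

    l₂⪯w : l₂ ⪯ w
    l₂⪯w = proj₂ (proj₁ w-min)

    r₁⋠ : ∀ {z} → z ⪯ r₂ → ¬ r₁ ⪯ z
    r₁⋠ z⪯r₂ r₁⪯z = proj₁ r₁∥r₂ (⪯-trans r₁⪯z z⪯r₂)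

    r₂⋠ : ∀ {z} → z ⪯ r₁ → ¬ r₂ ⪯ z
    r₂⋠ z⪯r₁ r₂⪯z = proj₂ r₁∥r₂ (⪯-trans r₂⪯z z⪯r₁)

    w⋠l₁ : ¬ w ⪯ l₁
    w⋠l₁ w⪯l₁ = proj₂ l₁∥l₂ (⪯-trans l₂⪯w w⪯l₁)

    w⋠l₂ : ¬ w ⪯ l₂
    w⋠l₂ w⪯l₂ = proj₁ l₁∥l₂ (⪯-trans l₁⪯w w⪯l₂)

    beyond-u : ∀ {z} → u ≺ z → z ⪯ r₂ → ¬ z ⪯ r₁
    beyond-u u≺z z⪯r₂ z⪯r₁ = proj₂ u-max (⪯-trans w⪯u (proj₁ u≺z) , z⪯r₁ , z⪯r₂) u≺z

    beneath-w : ∀ {z} → z ≺ w → l₂ ⪯ z → ¬ l₁ ⪯ z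
    beneath-w z≺w l₂⪯z l₁⪯z = proj₂ w-min (l₁⪯z , l₂⪯z) z≺w

    module X-case (u≡w : u ≡ w) where

      corners : Fin 5 → Fin n
      corners = lookup (r₁ ∷ r₂ ∷ w ∷ l₁ ∷ l₂ ∷ [])

      cell : Fin n → Cell 5
      cell z = if z ⪯ᵇ w
        then (if w ⪯ᵇ z then node 𝟚
              else if l₁ ⪯ᵇ z then (if z ⪯ᵇ l₁ then node 𝟛 else arc 𝟚 𝟛)
              else (if z ⪯ᵇ l₂ then node 𝟜 else arc 𝟚 𝟜))
        else (if z ⪯ᵇ r₁ then (if r₁ ⪯ᵇ z then node 𝟘 else arc 𝟘 𝟚)
              else (if r₂ ⪯ᵇ z then node 𝟙 else arc 𝟙 𝟚))

      cell-node : ∀ c → cell (corners c) ≡ node c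
      cell-node 𝟘 rewrite ⪯ᵇ-false (r₁⋠ w⪯r₂) | ⪯ᵇ-refl r₁ = refl
      cell-node 𝟙 rewrite ⪯ᵇ-false (r₂⋠ w⪯r₁) | ⪯ᵇ-false (proj₂ r₁∥r₂) | ⪯ᵇ-refl r₂ = refl
      cell-node 𝟚 rewrite ⪯ᵇ-refl w = refl
      cell-node 𝟛 rewrite ⪯ᵇ-true l₁⪯w | ⪯ᵇ-false w⋠l₁ | ⪯ᵇ-refl l₁ = refl
      cell-node 𝟜 rewrite ⪯ᵇ-true l₂⪯w | ⪯ᵇ-false w⋠l₂ | ⪯ᵇ-false (proj₁ l₁∥l₂) | ⪯ᵇ-refl l₂ = refl

      cell-r₁w : ∀ {z} → w ≺ z → z ≺ r₁ → cell z ≡ arc 𝟘 𝟚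
      cell-r₁w w≺z z≺r₁
        rewrite ⪯ᵇ-false (≺⇒⋡ w≺z) | ⪯ᵇ-true (proj₁ z≺r₁) | ⪯ᵇ-false (≺⇒⋡ z≺r₁) = refl

      cell-r₂w : ∀ {z} → w ≺ z → z ≺ r₂ → cell z ≡ arc 𝟙 𝟚
      cell-r₂w w≺z z≺r₂
        rewrite ⪯ᵇ-false (≺⇒⋡ w≺z) | ⪯ᵇ-false (beyond-u (subst (_≺ _) (sym u≡w) w≺z) (proj₁ z≺r₂))
              | ⪯ᵇ-false (≺⇒⋡ z≺r₂) = refl

      cell-wl₁ : ∀ {z} → l₁ ≺ z → z ≺ w → cell z ≡ arc 𝟚 𝟛
      cell-wl₁ l₁≺z z≺w
        rewrite ⪯ᵇ-true (proj₁ z≺w) | ⪯ᵇ-false (≺⇒⋡ z≺w) | ⪯ᵇ-true (proj₁ l₁≺z)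
              | ⪯ᵇ-false (≺⇒⋡ l₁≺z) = refl

      cell-wl₂ : ∀ {z} → l₂ ≺ z → z ≺ w → cell z ≡ arc 𝟚 𝟜
      cell-wl₂ l₂≺z z≺w
        rewrite ⪯ᵇ-true (proj₁ z≺w) | ⪯ᵇ-false (≺⇒⋡ z≺w) | ⪯ᵇ-false (beneath-w z≺w (proj₁ l₂≺z))
              | ⪯ᵇ-false (≺⇒⋡ l₂≺z) = refl

      arc-interval : ∀ {a b} → Edge X a b → CellInterval cell (corners a) (corners b) (arc a b)
      arc-interval {𝟘} {𝟚} _ = ⪯∧⋡⇒≺ w⪯r₁ (r₁⋠ w⪯r₂) , cell-r₁w
      arc-interval {𝟙} {𝟚} _ = ⪯∧⋡⇒≺ w⪯r₂ (r₂⋠ w⪯r₁) , cell-r₂w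
      arc-interval {𝟚} {𝟛} _ = ⪯∧⋡⇒≺ l₁⪯w w⋠l₁ , cell-wl₁
      arc-interval {𝟚} {𝟜} _ = ⪯∧⋡⇒≺ l₂⪯w w⋠l₂ , cell-wl₂

      model : IntervalModel X corners
      model = record { cell = cell ; cell-node = cell-node ; arc-interval = arc-interval }

    module X′-case (u≢w : u ≢ w) where

      corners : Fin 6 → Fin n
      corners = lookup (r₁ ∷ r₂ ∷ u ∷ w ∷ l₁ ∷ l₂ ∷ [])

      cell : Fin n → Cell 6
      cell z = if z ⪯ᵇ w
        then (if w ⪯ᵇ z then node 𝟛
              else if l₁ ⪯ᵇ z then (if z ⪯ᵇ l₁ then node 𝟜 else arc 𝟛 𝟜)
              else (if z ⪯ᵇ l₂ then node 𝟝 else arc 𝟛 𝟝))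
        else if z ⪯ᵇ u then (if u ⪯ᵇ z then node 𝟚 else arc 𝟚 𝟛)
        else (if z ⪯ᵇ r₁ then (if r₁ ⪯ᵇ z then node 𝟘 else arc 𝟘 𝟚)
              else (if r₂ ⪯ᵇ z then node 𝟙 else arc 𝟙 𝟚))

      u⋠w : ¬ u ⪯ w
      u⋠w u⪯w = u≢w (⪯-antisym u⪯w w⪯u)

      above-u⋠w : ∀ {z} → u ≺ z → ¬ z ⪯ w
      above-u⋠w u≺z z⪯w = ≺⇒⋡ u≺z (⪯-trans z⪯w w⪯u)

      cell-node : ∀ c → cell (corners c) ≡ node c
      cell-node 𝟘 rewrite ⪯ᵇ-false (r₁⋠ w⪯r₂) | ⪯ᵇ-false (r₁⋠ u⪯r₂) | ⪯ᵇ-refl r₁ = refl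
      cell-node 𝟙
        rewrite ⪯ᵇ-false (r₂⋠ w⪯r₁) | ⪯ᵇ-false (r₂⋠ u⪯r₁) | ⪯ᵇ-false (proj₂ r₁∥r₂) | ⪯ᵇ-refl r₂ = refl
      cell-node 𝟚 rewrite ⪯ᵇ-false u⋠w | ⪯ᵇ-refl u = refl
      cell-node 𝟛 rewrite ⪯ᵇ-refl w = refl
      cell-node 𝟜 rewrite ⪯ᵇ-true l₁⪯w | ⪯ᵇ-false w⋠l₁ | ⪯ᵇ-refl l₁ = refl
      cell-node 𝟝 rewrite ⪯ᵇ-true l₂⪯w | ⪯ᵇ-false w⋠l₂ | ⪯ᵇ-false (proj₁ l₁∥l₂) | ⪯ᵇ-refl l₂ = refl

      cell-r₁u : ∀ {z} → u ≺ z → z ≺ r₁ → cell z ≡ arc 𝟘 𝟚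
      cell-r₁u u≺z z≺r₁
        rewrite ⪯ᵇ-false (above-u⋠w u≺z) | ⪯ᵇ-false (≺⇒⋡ u≺z) | ⪯ᵇ-true (proj₁ z≺r₁)
              | ⪯ᵇ-false (≺⇒⋡ z≺r₁) = refl

      cell-r₂u : ∀ {z} → u ≺ z → z ≺ r₂ → cell z ≡ arc 𝟙 𝟚
      cell-r₂u u≺z z≺r₂
        rewrite ⪯ᵇ-false (above-u⋠w u≺z) | ⪯ᵇ-false (≺⇒⋡ u≺z)
              | ⪯ᵇ-false (beyond-u u≺z (proj₁ z≺r₂)) | ⪯ᵇ-false (≺⇒⋡ z≺r₂) = refl

      cell-uw : ∀ {z} → w ≺ z → z ≺ u → cell z ≡ arc 𝟚 𝟛
      cell-uw w≺z z≺u
        rewrite ⪯ᵇ-false (≺⇒⋡ w≺z) | ⪯ᵇ-true (proj₁ z≺u) | ⪯ᵇ-false (≺⇒⋡ z≺u) = refl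

      cell-wl₁ : ∀ {z} → l₁ ≺ z → z ≺ w → cell z ≡ arc 𝟛 𝟜
      cell-wl₁ l₁≺z z≺w
        rewrite ⪯ᵇ-true (proj₁ z≺w) | ⪯ᵇ-false (≺⇒⋡ z≺w) | ⪯ᵇ-true (proj₁ l₁≺z)
              | ⪯ᵇ-false (≺⇒⋡ l₁≺z) = refl

      cell-wl₂ : ∀ {z} → l₂ ≺ z → z ≺ w → cell z ≡ arc 𝟛 𝟝
      cell-wl₂ l₂≺z z≺w
        rewrite ⪯ᵇ-true (proj₁ z≺w) | ⪯ᵇ-false (≺⇒⋡ z≺w) | ⪯ᵇ-false (beneath-w z≺w (proj₁ l₂≺z))
              | ⪯ᵇ-false (≺⇒⋡ l₂≺z) = refl

      arc-interval : ∀ {a b} → Edge X' a b → CellInterval cell (corners a) (corners b) (arc a b)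
      arc-interval {𝟘} {𝟚} _ = ⪯∧⋡⇒≺ u⪯r₁ (r₁⋠ u⪯r₂) , cell-r₁u
      arc-interval {𝟙} {𝟚} _ = ⪯∧⋡⇒≺ u⪯r₂ (r₂⋠ u⪯r₁) , cell-r₂u
      arc-interval {𝟚} {𝟛} _ = ⪯∧⋡⇒≺ w⪯u u⋠w , cell-uw
      arc-interval {𝟛} {𝟜} _ = ⪯∧⋡⇒≺ l₁⪯w w⋠l₁ , cell-wl₁
      arc-interval {𝟛} {𝟝} _ = ⪯∧⋡⇒≺ l₂⪯w w⋠l₂ , cell-wl₂

      model : IntervalModel X' corners
      model = record { cell = cell ; cell-node = cell-node ; arc-interval = arc-interval }

    realise-X-or-X′ : ∀ {k₀} {F₀ : Digraph k₀} {H : FSubdivision F₀ N} →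
                      RootsLeaves H r₁ r₂ l₁ l₂ →
                      Σ (FSubdivision X N) (SameLR H) ⊎ Σ (FSubdivision X' N) (SameLR H)
    realise-X-or-X′ H-rl with u ≟ w
    ... | yes u≡w = inj₁ (realise-sameLR X-sourcesSinks (X-case.model u≡w) H-rl)
    ... | no u≢w  = inj₂ (realise-sameLR X′-sourcesSinks (X′-case.model u≢w) H-rl)

  LCA-unique : GlobalLCA N → ∀ {A v v′} → Nonempty A → IsLCA N A v → IsLCA N A v′ → v ≡ v′
  LCA-unique gl {A} A≢∅ v-lca v′-lca with gl A A≢∅
  ... | _ , _ , unique = trans (unique _ v-lca) (sym (unique _ v′-lca))

  module StrictK22 (H : FSubdivision K22 N) (H-strict : IsStrict H) where

    r₁ r₂ l₁ l₂ : Fin n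
    r₁ = branch H 𝟘
    r₂ = branch H 𝟙
    l₁ = branch H 𝟚
    l₂ = branch H 𝟛

    H-rl : RootsLeaves H r₁ r₂ l₁ l₂
    H-rl = branch-rootsLeaves dag K22-sourcesSinks H (λ _ → refl)

    r₁∥r₂ : Incomparable N r₁ r₂
    r₁∥r₂ = proj₁ H-strict r₁ r₂ (from (roots H-rl r₁) (inj₁ refl)) (from (roots H-rl r₂) (inj₂ refl))
                  ((λ ()) ∘ branch-injective H)

    l₁∥l₂ : Incomparable N l₁ l₂
    l₁∥l₂ = proj₂ H-strict l₁ l₂ (from (leaves H-rl l₁) (inj₁ refl)) (from (leaves H-rl l₂) (inj₂ refl))
                  ((λ ()) ∘ branch-injective H)

    r₁-above : CommonAncestor l₁ l₂ r₁
    r₁-above = branch-⪯ H {𝟘} {𝟚} refl , branch-⪯ H {𝟘} {𝟛} refl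

    r₂-above : CommonAncestor l₁ l₂ r₂
    r₂-above = branch-⪯ H {𝟙} {𝟚} refl , branch-⪯ H {𝟙} {𝟛} refl

    X-or-X′-subdivision : GlobalLCA N → Σ (FSubdivision X N) (SameLR H) ⊎ Σ (FSubdivision X' N) (SameLR H)
    X-or-X′-subdivision gl
      with minimal-below (commonAncestor? l₁ l₂) r₁-above | minimal-below (commonAncestor? l₁ l₂) r₂-above
    ... | w , w⪯r₁ , w-min | w′ , w′⪯r₂ , w′-min
      with LCA-unique gl (l₁ , x∈p∪q⁺ (inj₁ (x∈⁅x⁆ l₁))) (pair-LCA w-min) (pair-LCA w′-min)
    ... | refl with maximal-above (between? w r₁ r₂) (here , w⪯r₁ , w′⪯r₂)
    ... | u , _ , u-max = XShape.realise-X-or-X′ r₁∥r₂ l₁∥l₂ w-min u-max H-rl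

  globalLCA⇒xcondition : GlobalLCA N → XCondition N
  globalLCA⇒xcondition gl H H-strict = StrictK22.X-or-X′-subdivision H H-strict gl

theorem4p4 : ∀ (n : ℕ) (N : Digraph n) → IsNetwork N →
    (GlobalLCA N → XCondition N) × (XCondition N → GlobalLCA N)
theorem4p4 n N net = globalLCA⇒xcondition (proj₁ net) , xcondition⇒globalLCA net
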